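{- Let $(G,k)$ be an instance of CTVD and suppose there is a vertex $u$ of $G$ adjacent to two distinct vertices $v$ and $v'$ that are both pendant vertices of $G$. Then $(G,k)$ is a yes-instance if and only if $(G - v, k)$ is a yes-instance.
   Context: CTVD: given a multigraph $G$ (loops and parallel edges allowed) and an integer $k$, decide whether there is $S\subseteq V(G)$ with $|S|\le k$ such that $G-S$ is simple and every connected component of $G-S$ is a clique or a tree. The degree of a vertex counts edges with multiplicity; a pendant vertex is a vertex of degree exactly one. -}

module Defs where

open import Data.Nat using (ℕ; zero; suc; _+_; _≤_)
open import Data.Bool using (true; false)
open import Data.Fin using (Fin; _≟_)
open import Data.Fin.Subset using (Subset; _∈_; _∉_; _⊆_; ∣_∣; _─_; _-_; ⊤)
open import Data.Fin.Subset.Properties using (_∈?_)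
open import Data.List using (List; []; _∷_; length; filter; map)
open import Data.Nat.ListAction using (sum)
import Data.Unit
import Data.Empty
import Data.Bool
open import Data.List.Relation.Unary.All using (All)
open import Data.List.Relation.Unary.Unique.Propositional using (Unique)
open import Data.Product using (_×_; _,_; proj₁; proj₂; Σ; ∃)
open import Data.Sum using (_⊎_)
open import Relation.Binary.PropositionalEquality using (_≡_; _≢_)
open import Relation.Binary.Construct.Closure.ReflexiveTransitive using (Star)
open import Relation.Nullary using (¬_; Dec; does)
open import Relation.Nullary.Decidable using (_×-dec_; _⊎-dec_)

-- A multigraph whose vertices form a subset  V  of  Fin n, with a list of
-- edges (each edge a pair of endpoints; a loop is a pair (x , x);
-- parallel edges are repeated list entries).  Only edges with both
-- endpoints in V belong to the graph, so deleting vertices only shrinks V.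
record MGraph (n : ℕ) : Set where
  constructor mgraph
  field
    V : Subset n
    E : List (Fin n × Fin n)
open MGraph public

full : ∀ {n} → List (Fin n × Fin n) → MGraph n
full E = mgraph ⊤ E

_∖ˢ_ : ∀ {n} → MGraph n → Subset n → MGraph n
G ∖ˢ S = mgraph (V G ─ S) (E G)

_∖ᵛ_ : ∀ {n} → MGraph n → Fin n → MGraph n
G ∖ᵛ v = mgraph (V G - v) (E G)

edges : ∀ {n} → MGraph n → List (Fin n × Fin n)
edges G = filter (λ e → (proj₁ e ∈? V G) ×-dec (proj₂ e ∈? V G)) (E G)

Joins : ∀ {n} → Fin n → Fin n → Fin n × Fin n → Set
Joins x y e = (proj₁ e ≡ x × proj₂ e ≡ y) ⊎ (proj₁ e ≡ y × proj₂ e ≡ x)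

joins? : ∀ {n} (x y : Fin n) (e : Fin n × Fin n) → Dec (Joins x y e)
joins? x y e = ((proj₁ e ≟ x) ×-dec (proj₂ e ≟ y)) ⊎-dec ((proj₁ e ≟ y) ×-dec (proj₂ e ≟ x))

-- number of edges of G joining x and y (number of loops at x when x = y)
mult : ∀ {n} → MGraph n → Fin n → Fin n → ℕ
mult G x y = length (filter (joins? x y) (edges G))

-- degree: edges counted with multiplicity, a loop contributes 2
ind : ∀ {n} → Fin n → Fin n → ℕ
ind x u with does (x ≟ u)
... | true  = 1
... | false = 0

degree : ∀ {n} → MGraph n → Fin n → ℕ
degree G u = sum (map (λ e → ind (proj₁ e) u + ind (proj₂ e) u) (edges G))

Pendant : ∀ {n} → MGraph n → Fin n → Set
Pendant G v = v ∈ V G × degree G v ≡ 1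

Adj : ∀ {n} → MGraph n → Fin n → Fin n → Set
Adj G x y = x ∈ V G × y ∈ V G × x ≢ y × 1 ≤ mult G x y

Simple : ∀ {n} → MGraph n → Set
Simple G = ∀ x y → x ∈ V G → y ∈ V G → mult G x y ≤ (Data.Bool.if does (x ≟ y) then 0 else 1)

Reach : ∀ {n} → MGraph n → Fin n → Fin n → Set
Reach G x y = x ∈ V G × Star (Adj G) x y

Walk : ∀ {n} → MGraph n → List (Fin n) → Set
Walk G []           = Data.Unit.⊤
Walk G (x ∷ [])     = Data.Unit.⊤
Walk G (x ∷ y ∷ xs) = Adj G x y × Walk G (y ∷ xs)

last : ∀ {n} → Fin n → List (Fin n) → Fin n
last x []       = x
last x (y ∷ ys) = last y ys

Cycle : ∀ {n} → MGraph n → List (Fin n) → Set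
Cycle G []       = Data.Empty.⊥
Cycle G (x ∷ xs) = 3 ≤ length (x ∷ xs) × Unique (x ∷ xs) × Walk G (x ∷ xs) × Adj G (last x xs) x

CompClique : ∀ {n} → MGraph n → Fin n → Set
CompClique G x = ∀ y z → Reach G x y → Reach G x z → y ≢ z → Adj G y z

-- the component of x is a tree (it is connected; require it to be acyclic)
CompTree : ∀ {n} → MGraph n → Fin n → Set
CompTree G x = ∀ c → All (Reach G x) c → ¬ Cycle G c

CliqueTreeGraph : ∀ {n} → MGraph n → Set
CliqueTreeGraph G = Simple G × (∀ x → x ∈ V G → CompClique G x ⊎ CompTree G x)

YesCTVD : ∀ {n} → MGraph n → ℕ → Set
YesCTVD G k = Σ (Subset _) λ S → S ⊆ V G × ∣ S ∣ ≤ k × CliqueTreeGraph (G ∖ˢ S)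

-- Clique-or-tree graphs are closed under vertex deletion, which gives the
-- forward direction.  For the converse, a vertex of degree at most one lies on
-- no cycle and can only join the component of its neighbour, so it can be added
-- back to a clique-or-tree graph whenever its neighbour is absent or lies in a
-- tree component.  Let S′ solve (G - v, k).  If u ∈ S′, then v is isolated in
-- G - S′.  If u, v′ ∉ S′, the component of u in G - v - S′ contains the pendant
-- vertex v′, so it is not a clique on three or more vertices and hence a tree.
-- If u ∉ S′ but v′ ∈ S′, exchanging v′ for u gives a solution of the same size,
-- since deleting u leaves both v and v′ isolated.

module Submission where

open import Defs
open import Data.Nat using (ℕ; zero; suc; _+_; _*_; _≤_; _<_; z≤n; s≤s; _≤?_)
open import Data.Nat.Properties
  using (≤-refl; ≤-reflexive; ≤-trans; m≤m+n; m≤n+m; n≤1+n; n≤0⇒n≡0; 1+n≰n;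
         +-comm; +-suc; +-mono-≤; +-monoʳ-≤; *-identityʳ; module ≤-Reasoning)
open import Data.Fin using (Fin; _≟_)
open import Data.Fin.Subset using (Subset; _∈_; _∉_; _⊆_; ∣_∣; _─_; _-_; _∪_; ⁅_⁆; ⊤; inside; outside)
open import Data.Fin.Subset.Properties
  using (_∈?_; ∈⊤; x∈⁅x⁆; x∈p∪q⁺; p─q⊆p; x∈p∧x∉q⇒x∈p─q; x∈p∧x≢y⇒x∈p-y; p─q─r≡p─r─q;
         ∣p─q∣≤∣p∣; x∈p⇒∣p-x∣<∣p∣; ∣⁅x⁆∣≡1)
open import Data.Vec.Base using ([]; _∷_; here; there)
open import Data.List using (List; []; _∷_; length; filter; map)
open import Data.List.Properties using (filter-≐)
open import Data.List.Relation.Unary.All as All using (All; []; _∷_)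
open import Data.List.Relation.Unary.AllPairs using (_∷_)
open import Data.List.Relation.Unary.Any using (here; there)
open import Data.List.Relation.Unary.Unique.Propositional using (Unique)
open import Data.List.Membership.Propositional using () renaming (_∈_ to _∈ₗ_)
open import Data.Nat.ListAction using (sum)
import Data.Product as Product
open import Data.Product using (_×_; _,_; proj₁; proj₂; ∃; ∃₂; uncurry)
open import Function.Base using (_∘_)
open import Data.Sum using (_⊎_; inj₁; inj₂; [_,_])
open import Function.Bundles using (_⇔_; mk⇔)
open import Relation.Binary.PropositionalEquality
  using (_≡_; _≢_; refl; sym; trans; cong; subst; ≢-sym)
open import Relation.Binary.Construct.Closure.ReflexiveTransitive using (Star; ε; _◅_)
import Relation.Binary.Construct.Closure.ReflexiveTransitive as Star
open import Relation.Nullary using (¬_; Dec; yes; no; ¬?; contradiction)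
open import Relation.Nullary.Decidable using (_×-dec_; _⊎-dec_)
open import Relation.Unary using (Pred; Decidable)

module _ {a p q} {A : Set a} {P : Pred A p} {Q : Pred A q} (P? : Decidable P) (Q? : Decidable Q) where

  filter-absorbs : (∀ {x} → P x → Q x) → ∀ xs → filter P? (filter Q? xs) ≡ filter P? xs
  filter-absorbs P⇒Q [] = refl
  filter-absorbs P⇒Q (x ∷ xs) with Q? x
  ... | yes _ with P? x
  ...   | yes _ = cong (x ∷_) (filter-absorbs P⇒Q xs)
  ...   | no _  = filter-absorbs P⇒Q xs
  filter-absorbs P⇒Q (x ∷ xs) | no ¬q with P? x
  ...   | yes px = contradiction (P⇒Q px) ¬q
  ...   | no _   = filter-absorbs P⇒Q xs

  length-filter-⊎ : (∀ {x} → P x → ¬ Q x) → ∀ xs →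
                    length (filter (λ x → P? x ⊎-dec Q? x) xs) ≡
                    length (filter P? xs) + length (filter Q? xs)
  length-filter-⊎ P⇒¬Q [] = refl
  length-filter-⊎ P⇒¬Q (x ∷ xs) with P? x | Q? x
  ... | yes px | yes qx = contradiction qx (P⇒¬Q px)
  ... | yes _  | no _   = cong suc (length-filter-⊎ P⇒¬Q xs)
  ... | no _   | yes _  = trans (cong suc (length-filter-⊎ P⇒¬Q xs)) (sym (+-suc _ _))
  ... | no _   | no _   = length-filter-⊎ P⇒¬Q xs

module _ {a p} {A : Set a} {P : Pred A p} (P? : Decidable P) (f : A → ℕ) where

  sum-filter-≤ : ∀ xs → sum (map f (filter P? xs)) ≤ sum (map f xs)
  sum-filter-≤ [] = z≤n
  sum-filter-≤ (x ∷ xs) with P? x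
  ... | yes _ = +-mono-≤ ≤-refl (sum-filter-≤ xs)
  ... | no _  = ≤-trans (sum-filter-≤ xs) (m≤n+m _ _)

  length-filter*≤sum : ∀ {c} → (∀ {x} → P x → c ≤ f x) → ∀ xs →
                       length (filter P? xs) * c ≤ sum (map f xs)
  length-filter*≤sum c≤f [] = z≤n
  length-filter*≤sum c≤f (x ∷ xs) with P? x
  ... | yes px = +-mono-≤ (c≤f px) (length-filter*≤sum c≤f xs)
  ... | no _   = ≤-trans (length-filter*≤sum c≤f xs) (m≤n+m _ _)

x∈p─q⇒x∉q : ∀ {n} {x : Fin n} {p q : Subset n} → x ∈ p ─ q → x ∉ q
x∈p─q⇒x∉q {p = inside ∷ p} {outside ∷ q} here       ()
x∈p─q⇒x∉q {p = _ ∷ p}      {_ ∷ q}       (there x∈) (there x∈q) = x∈p─q⇒x∉q x∈ x∈q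

x∈p-y⇒x≢y : ∀ {n} {x y : Fin n} {p : Subset n} → x ∈ p - y → x ≢ y
x∈p-y⇒x≢y x∈ refl = x∈p─q⇒x∉q x∈ (x∈⁅x⁆ _)

∣p∪q∣≤∣p∣+∣q∣ : ∀ {n} (p q : Subset n) → ∣ p ∪ q ∣ ≤ ∣ p ∣ + ∣ q ∣
∣p∪q∣≤∣p∣+∣q∣ []            []            = z≤n
∣p∪q∣≤∣p∣+∣q∣ (inside ∷ p)  (inside ∷ q)  = s≤s (≤-trans (∣p∪q∣≤∣p∣+∣q∣ p q) (+-monoʳ-≤ ∣ p ∣ (n≤1+n ∣ q ∣)))
∣p∪q∣≤∣p∣+∣q∣ (inside ∷ p)  (outside ∷ q) = s≤s (∣p∪q∣≤∣p∣+∣q∣ p q)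
∣p∪q∣≤∣p∣+∣q∣ (outside ∷ p) (inside ∷ q)  = subst (∣ p ∪ q ∣ <_) (sym (+-suc ∣ p ∣ ∣ q ∣)) (s≤s (∣p∪q∣≤∣p∣+∣q∣ p q))
∣p∪q∣≤∣p∣+∣q∣ (outside ∷ p) (outside ∷ q) = ∣p∪q∣≤∣p∣+∣q∣ p q

module _ {n} (G : MGraph n) where

  mult-sym : ∀ x y → mult G x y ≡ mult G y x
  mult-sym x y = cong length (filter-≐ (joins? x y) (joins? y x) (swap , swap) (edges G))
    where
    swap : ∀ {a b e} → Joins a b e → Joins b a e
    swap (inj₁ p) = inj₂ p
    swap (inj₂ p) = inj₁ p

  Adj-sym : ∀ {x y} → Adj G x y → Adj G y x
  Adj-sym {x} {y} (x∈ , y∈ , x≢y , 1≤m) = y∈ , x∈ , ≢-sym x≢y , subst (1 ≤_) (mult-sym x y) 1≤m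

  adj? : ∀ x y → Dec (Adj G x y)
  adj? x y = (x ∈? V G) ×-dec (y ∈? V G) ×-dec ¬? (x ≟ y) ×-dec (1 ≤? mult G x y)

  Reach⇒∈V : ∀ {x y} → Reach G x y → y ∈ V G
  Reach⇒∈V (x∈ , x~*y) = Star-∈V x∈ x~*y
    where
    Star-∈V : ∀ {x y} → x ∈ V G → Star (Adj G) x y → y ∈ V G
    Star-∈V x∈ ε                    = x∈
    Star-∈V _  ((_ , z∈ , _) ◅ z~*y) = Star-∈V z∈ z~*y

  ∉V⇒CompTree : ∀ {x} → x ∉ V G → CompTree G x
  ∉V⇒CompTree x∉ (_ ∷ _) (x~*y ∷ _) _ = x∉ (proj₁ x~*y)

  Simple⇒loopless : Simple G → ∀ {x} → x ∈ V G → mult G x x ≡ 0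
  Simple⇒loopless simple {x} x∈ with x ≟ x | simple x x x∈ x∈
  ... | yes _   | m≤0 = n≤0⇒n≡0 m≤0
  ... | no x≢x | _   = contradiction refl x≢x

  Simple⇒mult≤1 : Simple G → ∀ {x y} → x ∈ V G → y ∈ V G → mult G x y ≤ 1
  Simple⇒mult≤1 simple {x} {y} x∈ y∈ with x ≟ y | simple x y x∈ y∈
  ... | yes _ | m≤0 = ≤-trans m≤0 z≤n
  ... | no _  | m≤1 = m≤1

  loopless∧mult≤1⇒Simple : (∀ {x} → x ∈ V G → mult G x x ≡ 0) →
                           (∀ {x y} → x ∈ V G → y ∈ V G → mult G x y ≤ 1) → Simple G
  loopless∧mult≤1⇒Simple loopless mult≤1 x y x∈ y∈ with x ≟ y
  ... | yes refl = ≤-reflexive (loopless x∈)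
  ... | no _     = mult≤1 x∈ y∈

incidence : ∀ {n} → Fin n → Fin n × Fin n → ℕ
incidence w e = ind (proj₁ e) w + ind (proj₂ e) w

ind-refl : ∀ {n} (x : Fin n) → ind x x ≡ 1
ind-refl x with x ≟ x
... | yes _   = refl
... | no x≢x = contradiction refl x≢x

joins⇒1≤incidence : ∀ {n} {w y : Fin n} {e} → Joins w y e → 1 ≤ incidence w e
joins⇒1≤incidence {w = w} (inj₁ (refl , refl)) = ≤-trans (≤-reflexive (sym (ind-refl w))) (m≤m+n _ _)
joins⇒1≤incidence {w = w} (inj₂ (refl , refl)) = ≤-trans (≤-reflexive (sym (ind-refl w))) (m≤n+m _ _)

loop⇒2≤incidence : ∀ {n} {w : Fin n} {e} → Joins w w e → 2 ≤ incidence w e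
loop⇒2≤incidence {w = w} (inj₁ (refl , refl)) rewrite ind-refl w = ≤-refl
loop⇒2≤incidence {w = w} (inj₂ (refl , refl)) rewrite ind-refl w = ≤-refl

joins-disjoint : ∀ {n} {w y y′ : Fin n} {e} → y ≢ y′ → w ≢ y → w ≢ y′ → Joins w y e → ¬ Joins w y′ e
joins-disjoint y≢y′ _   _    (inj₁ (refl , refl)) (inj₁ (_ , y≡y′)) = y≢y′ y≡y′
joins-disjoint _    _   w≢y′ (inj₁ (refl , refl)) (inj₂ (w≡y′ , _)) = w≢y′ w≡y′
joins-disjoint _    w≢y _    (inj₂ (refl , refl)) (inj₁ (y≡w , _)) = w≢y (sym y≡w)
joins-disjoint y≢y′ _   _    (inj₂ (refl , refl)) (inj₂ (y≡y′ , _)) = y≢y′ y≡y′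

module _ {n} (G : MGraph n) {w : Fin n} (deg≤1 : degree G w ≤ 1) where

  private
    edges-at≤degree : ∀ {p} {P : Pred (Fin n × Fin n) p} (P? : Decidable P) →
                      (∀ {e} → P e → 1 ≤ incidence w e) → length (filter P? (edges G)) ≤ degree G w
    edges-at≤degree P? 1≤incidence =
      ≤-trans (≤-reflexive (sym (*-identityʳ _))) (length-filter*≤sum P? (incidence w) 1≤incidence (edges G))

  degree≤1⇒loopless : mult G w w ≡ 0
  degree≤1⇒loopless =
    n*2≤1⇒n≡0 _ (≤-trans (length-filter*≤sum (joins? w w) (incidence w) loop⇒2≤incidence (edges G)) deg≤1)
    where
    n*2≤1⇒n≡0 : ∀ m → m * 2 ≤ 1 → m ≡ 0
    n*2≤1⇒n≡0 zero    _ = refl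
    n*2≤1⇒n≡0 (suc m) (s≤s ())

  degree≤1⇒mult≤1 : ∀ y → mult G w y ≤ 1
  degree≤1⇒mult≤1 y = ≤-trans (edges-at≤degree (joins? w y) joins⇒1≤incidence) deg≤1

  degree≤1⇒unique-neighbour : ∀ {y y′} → Adj G w y → Adj G w y′ → y ≡ y′
  degree≤1⇒unique-neighbour {y} {y′} (_ , _ , w≢y , 1≤wy) (_ , _ , w≢y′ , 1≤wy′) with y ≟ y′
  ... | yes y≡y′ = y≡y′
  ... | no y≢y′  = contradiction (≤-trans two-edges deg≤1) 1+n≰n
    where
    open ≤-Reasoning
    two-edges : 2 ≤ degree G w
    two-edges = begin
      2                        ≤⟨ +-mono-≤ 1≤wy 1≤wy′ ⟩
      mult G w y + mult G w y′
        ≡⟨ length-filter-⊎ (joins? w y) (joins? w y′) (joins-disjoint y≢y′ w≢y w≢y′) (edges G) ⟨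
      length (filter (λ e → joins? w y e ⊎-dec joins? w y′ e) (edges G))
        ≤⟨ edges-at≤degree _ [ joins⇒1≤incidence , joins⇒1≤incidence ] ⟩
      degree G w               ∎

last∈ : ∀ {n} (x : Fin n) xs → last x xs ∈ₗ x ∷ xs
last∈ x []       = here refl
last∈ x (y ∷ ys) = there (last∈ y ys)

module _ {n} (G : MGraph n) where

  TwoNeighbours : Fin n → Set
  TwoNeighbours x = ∃₂ λ y y′ → y ≢ y′ × Adj G x y × Adj G x y′

  walk-inner⇒two-neighbours : ∀ {a x L} → Walk G (a ∷ L) → Unique (a ∷ L) →
                              x ∈ₗ L → x ≢ last a L → TwoNeighbours x
  walk-inner⇒two-neighbours {L = _ ∷ []} _ _ (here refl) x≢last = contradiction refl x≢last
  walk-inner⇒two-neighbours {a} {L = _ ∷ c ∷ _} (a~b , b~c , _) ((_ ∷ a≢c ∷ _) ∷ _) (here refl) _ =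
    a , c , a≢c , Adj-sym G a~b , b~c
  walk-inner⇒two-neighbours {L = _ ∷ _ ∷ _} (_ , walk) (_ ∷ distinct) (there x∈) x≢last =
    walk-inner⇒two-neighbours walk distinct x∈ x≢last

  walk⇒last-predecessor : ∀ {a b L} → Walk G (a ∷ b ∷ L) → ∃ λ p → p ∈ₗ a ∷ b ∷ L × Adj G p (last b L)
  walk⇒last-predecessor {a} {L = []}    (a~b , _) = a , here refl , a~b
  walk⇒last-predecessor {L = _ ∷ _} (_ , walk) with walk⇒last-predecessor walk
  ... | p , p∈ , p~last = p , there p∈ , p~last

  cycle⇒two-neighbours : ∀ {c x} → Cycle G c → x ∈ₗ c → TwoNeighbours x
  cycle⇒two-neighbours {_ ∷ []}    (s≤s () , _)
  cycle⇒two-neighbours {_ ∷ _ ∷ []} (s≤s (s≤s ()) , _)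
  cycle⇒two-neighbours {a ∷ b ∷ c ∷ L} (_ , _ ∷ (b≢ ∷ _) , walk , closing) (here refl) =
    b , last c L , All.lookup b≢ (last∈ c L) , proj₁ walk , Adj-sym G closing
  cycle⇒two-neighbours {a ∷ b ∷ c ∷ L} {x} (_ , distinct@(a≢ ∷ _) , walk , closing) (there x∈)
    with x ≟ last c L
  ... | no x≢last = walk-inner⇒two-neighbours walk distinct x∈ x≢last
  ... | yes refl with walk⇒last-predecessor (proj₂ walk)
  ...   | p , p∈ , p~x = p , a , ≢-sym (All.lookup a≢ p∈) , Adj-sym G p~x , closing

  degree≤1⇒off-cycles : ∀ {w c} → degree G w ≤ 1 → Cycle G c → All (_≢ w) c
  degree≤1⇒off-cycles deg≤1 cycle = All.tabulate λ { x∈ refl →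
    let _ , _ , y≢y′ , w~y , w~y′ = cycle⇒two-neighbours cycle x∈
    in y≢y′ (degree≤1⇒unique-neighbour G deg≤1 w~y w~y′) }

  clique-with-leaf⇒tree : ∀ {x y} → degree G y ≤ 1 → Adj G x y → CompClique G x → CompTree G x
  clique-with-leaf⇒tree {x} {y} deg≤1 x~y clique = acyclic
    where
    x~*y : Reach G x y
    x~*y = proj₁ x~y , x~y ◅ ε

    leaf-neighbours-equal : ∀ {p q} → Reach G x p → Reach G x q → p ≢ y → q ≢ y → p ≡ q
    leaf-neighbours-equal x~*p x~*q p≢y q≢y =
      degree≤1⇒unique-neighbour G deg≤1 (clique y _ x~*y x~*p (≢-sym p≢y)) (clique y _ x~*y x~*q (≢-sym q≢y))

    acyclic : CompTree G x
    acyclic (_ ∷ []) _ (s≤s () , _)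
    acyclic (_ ∷ _ ∷ []) _ (s≤s (s≤s ()) , _)
    acyclic (a ∷ b ∷ c ∷ _) (x~*a ∷ x~*b ∷ x~*c ∷ _) (_ , (a≢b ∷ a≢c ∷ _) ∷ (b≢c ∷ _) ∷ _ , _)
      with a ≟ y | b ≟ y
    ... | yes refl | _        = b≢c (leaf-neighbours-equal x~*b x~*c (≢-sym a≢b) (≢-sym a≢c))
    ... | no a≢y   | yes refl = a≢c (leaf-neighbours-equal x~*a x~*c a≢y (≢-sym b≢c))
    ... | no a≢y   | no b≢y   = a≢b (leaf-neighbours-equal x~*a x~*b a≢y b≢y)

module _ {n} (E : List (Fin n × Fin n)) where

  induced : Subset n → MGraph n
  induced A = mgraph A E

  mult-induced : ∀ {A B x y} → x ∈ A → y ∈ A → x ∈ B → y ∈ B →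
                 mult (induced A) x y ≡ mult (induced B) x y
  mult-induced x∈A y∈A x∈B y∈B = trans (mult-all-edges x∈A y∈A) (sym (mult-all-edges x∈B y∈B))
    where
    mult-all-edges : ∀ {A x y} → x ∈ A → y ∈ A → mult (induced A) x y ≡ length (filter (joins? x y) E)
    mult-all-edges {A} {x} {y} x∈ y∈ = cong length (filter-absorbs (joins? x y) _ ends-in-A E)
      where
      ends-in-A : ∀ {e} → Joins x y e → proj₁ e ∈ A × proj₂ e ∈ A
      ends-in-A (inj₁ (refl , refl)) = x∈ , y∈
      ends-in-A (inj₂ (refl , refl)) = y∈ , x∈

  Adj-induced : ∀ {A B x y} → Adj (induced A) x y → x ∈ B → y ∈ B → Adj (induced B) x y
  Adj-induced (x∈A , y∈A , x≢y , 1≤m) x∈B y∈B =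
    x∈B , y∈B , x≢y , subst (1 ≤_) (mult-induced x∈A y∈A x∈B y∈B) 1≤m

  Walk-induced : ∀ {A B} c → All (_∈ B) c → Walk (induced A) c → Walk (induced B) c
  Walk-induced []          _                  _            = _
  Walk-induced (_ ∷ [])    _                  _            = _
  Walk-induced (x ∷ y ∷ c) (x∈ ∷ ∈B@(y∈ ∷ _)) (x~y , walk) =
    Adj-induced x~y x∈ y∈ , Walk-induced (y ∷ c) ∈B walk

  Cycle-induced : ∀ {A B c} → All (_∈ B) c → Cycle (induced A) c → Cycle (induced B) c
  Cycle-induced {c = x ∷ c} ∈B (long , distinct , walk , closing) =
    long , distinct , Walk-induced (x ∷ c) ∈B walk ,
    Adj-induced closing (All.lookup ∈B (last∈ x c)) (All.head ∈B)

  Star-induced : ∀ {A B x y} → B ⊆ A → Star (Adj (induced B)) x y → Star (Adj (induced A)) x y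
  Star-induced B⊆A = Star.map λ x~y@(x∈ , y∈ , _) → Adj-induced x~y (B⊆A x∈) (B⊆A y∈)

  degree-induced : ∀ {A B} w → B ⊆ A → degree (induced B) w ≤ degree (induced A) w
  degree-induced {A} {B} w B⊆A = begin
    degree (induced B) w
      ≡⟨ cong (sum ∘ map (incidence w)) (filter-absorbs (in? B) (in? A) (Product.map B⊆A B⊆A) E) ⟨
    sum (map (incidence w) (filter (in? B) (filter (in? A) E)))
      ≤⟨ sum-filter-≤ (in? B) (incidence w) (filter (in? A) E) ⟩
    degree (induced A) w
      ∎
    where
    open ≤-Reasoning
    in? : ∀ X (e : Fin n × Fin n) → Dec (proj₁ e ∈ X × proj₂ e ∈ X)
    in? X e = (proj₁ e ∈? X) ×-dec (proj₂ e ∈? X)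

  CliqueTreeGraph-induced : ∀ {A B} → B ⊆ A → CliqueTreeGraph (induced A) → CliqueTreeGraph (induced B)
  CliqueTreeGraph-induced {A} {B} B⊆A (simple , component) =
    loopless∧mult≤1⇒Simple (induced B) loopless mult≤1 , component-B
    where
    loopless : ∀ {x} → x ∈ B → mult (induced B) x x ≡ 0
    loopless x∈ = trans (mult-induced x∈ x∈ (B⊆A x∈) (B⊆A x∈)) (Simple⇒loopless (induced A) simple (B⊆A x∈))
    mult≤1 : ∀ {x y} → x ∈ B → y ∈ B → mult (induced B) x y ≤ 1
    mult≤1 x∈ y∈ = subst (_≤ 1) (mult-induced (B⊆A x∈) (B⊆A y∈) x∈ y∈)
                         (Simple⇒mult≤1 (induced A) simple (B⊆A x∈) (B⊆A y∈))
    reach-A : ∀ {x y} → Reach (induced B) x y → Reach (induced A) x y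
    reach-A (x∈ , x~*y) = B⊆A x∈ , Star-induced B⊆A x~*y
    component-B : ∀ x → x ∈ B → CompClique (induced B) x ⊎ CompTree (induced B) x
    component-B x x∈ with component x (B⊆A x∈)
    ... | inj₁ clique = inj₁ λ y z x~*y x~*z y≢z →
      Adj-induced (clique y z (reach-A x~*y) (reach-A x~*z) y≢z)
                  (Reach⇒∈V (induced B) x~*y) (Reach⇒∈V (induced B) x~*z)
    ... | inj₂ tree = inj₂ λ c x~*c cycle →
      tree c (All.map reach-A x~*c) (Cycle-induced (All.map (B⊆A ∘ Reach⇒∈V (induced B)) x~*c) cycle)

module _ {n} (E : List (Fin n × Fin n)) {A : Subset n} {w u : Fin n}
         (deg≤1 : degree (induced E A) w ≤ 1)
         (w-neighbour : ∀ {y} → Adj (induced E A) w y → y ≡ u)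
         (u-tree : CompTree (induced E (A - w)) u)
         (ok : CliqueTreeGraph (induced E (A - w))) where

  private
    G H : MGraph n
    G = induced E A
    H = induced E (A - w)

    into-H : ∀ {x} → x ∈ A → x ≢ w → x ∈ A - w
    into-H = x∈p∧x≢y⇒x∈p-y

    out-of-H : ∀ {x} → x ∈ A - w → x ∈ A
    out-of-H = p─q⊆p A ⁅ w ⁆

    Adj-H : ∀ {x y} → Adj G x y → x ≢ w → y ≢ w → Adj H x y
    Adj-H x~y@(x∈ , y∈ , _) x≢w y≢w = Adj-induced E x~y (into-H x∈ x≢w) (into-H y∈ y≢w)

    Adj-G : ∀ {x y} → Adj H x y → Adj G x y
    Adj-G x~y@(x∈ , y∈ , _) = Adj-induced E x~y (out-of-H x∈) (out-of-H y∈)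

    -- A walk through w enters and leaves it via u, so the detour can be cut out.
    lower : ∀ {a y} → a ≢ w → y ≢ w → Star (Adj G) a y → Star (Adj H) a y
    lower a≢w y≢w ε = ε
    lower a≢w y≢w (_◅_ {j = b} a~b b~*y) with b ≟ w
    ... | no b≢w = Adj-H a~b a≢w b≢w ◅ lower b≢w y≢w b~*y
    ... | yes refl with b~*y
    ...   | ε = contradiction refl y≢w
    ...   | w~c ◅ c~*y with w-neighbour (Adj-sym G a~b) | w-neighbour w~c
    ...     | refl | refl = lower a≢w y≢w c~*y

    lower-reach : ∀ {x y} → x ≢ w → Reach G x y → y ≢ w → Reach H x y
    lower-reach x≢w (x∈ , x~*y) y≢w = into-H x∈ x≢w , lower x≢w y≢w x~*y

    reach-to-w : ∀ {a} → a ≢ w → Star (Adj G) a w → Star (Adj H) a u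
    reach-to-w a≢w ε = contradiction refl a≢w
    reach-to-w a≢w (_◅_ {j = b} a~b b~*w) with b ≟ w
    ... | no b≢w = Adj-H a~b a≢w b≢w ◅ reach-to-w b≢w b~*w
    ... | yes refl with w-neighbour (Adj-sym G a~b)
    ...   | refl = ε

    reach-from-w : ∀ {y} → y ≢ w → Reach G w y → Reach H u y
    reach-from-w y≢w (_ , ε) = contradiction refl y≢w
    reach-from-w y≢w (_ , w~b@(_ , b∈ , w≢b , _) ◅ b~*y) with w-neighbour w~b
    ... | refl = lower-reach (≢-sym w≢b) (b∈ , b~*y) y≢w

    tree-via : ∀ {x} z → CompTree H z → (∀ {y} → Reach G x y → y ≢ w → Reach H z y) → CompTree G x
    tree-via z tree lift c x~*c cycle = tree c z~*c (Cycle-induced E (All.map (Reach⇒∈V H) z~*c) cycle)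
      where
      z~*c = All.zipWith (uncurry lift) (x~*c , degree≤1⇒off-cycles G deg≤1 cycle)

    -- The component of x meets w only if it contains u, i.e. only if x = u or x ~ u.
    clique-component : ∀ {x} → x ∈ A → x ≢ w → CompClique H x → CompClique G x ⊎ CompTree G x
    clique-component {x} x∈ x≢w clique with x ≟ u | adj? H x u
    ... | yes refl | _                    = inj₂ (tree-via x u-tree (lower-reach x≢w))
    ... | no _     | yes x~u@(_ , u∈ , _) = inj₂ (tree-via u u-tree λ x~*y y≢w →
                                              u∈ , Adj-sym H x~u ◅ proj₂ (lower-reach x≢w x~*y y≢w))
    ... | no x≢u   | no x≁u               = inj₁ λ y z x~*y x~*z y≢z →
      Adj-G (clique y z (lower-reach x≢w x~*y (avoids-w x~*y)) (lower-reach x≢w x~*z (avoids-w x~*z)) y≢z)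
      where
      avoids-w : ∀ {y} → Reach G x y → y ≢ w
      avoids-w (_ , x~*w) refl = x≁u (clique x u (x∈H , ε) (x∈H , reach-to-w x≢w x~*w) x≢u)
        where x∈H = into-H x∈ x≢w

    component : ∀ x → x ∈ A → CompClique G x ⊎ CompTree G x
    component x x∈ with x ≟ w
    ... | yes refl = inj₂ (tree-via u u-tree λ w~*y y≢w → reach-from-w y≢w w~*y)
    ... | no x≢w with proj₂ ok x (into-H x∈ x≢w)
    ...   | inj₁ clique = clique-component x∈ x≢w clique
    ...   | inj₂ tree   = inj₂ (tree-via x tree (lower-reach x≢w))

    loopless : ∀ {x} → x ∈ A → mult G x x ≡ 0
    loopless {x} x∈ with x ≟ w
    ... | yes refl = degree≤1⇒loopless G deg≤1
    ... | no x≢w   = trans (mult-induced E x∈ x∈ x∈H x∈H) (Simple⇒loopless H (proj₁ ok) x∈H)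
      where x∈H = into-H x∈ x≢w

    mult≤1 : ∀ {x y} → x ∈ A → y ∈ A → mult G x y ≤ 1
    mult≤1 {x} {y} x∈ y∈ with x ≟ w | y ≟ w
    ... | yes refl | _        = degree≤1⇒mult≤1 G deg≤1 y
    ... | no _     | yes refl = subst (_≤ 1) (mult-sym G w x) (degree≤1⇒mult≤1 G deg≤1 x)
    ... | no x≢w   | no y≢w   =
      subst (_≤ 1) (mult-induced E x∈H y∈H x∈ y∈) (Simple⇒mult≤1 H (proj₁ ok) x∈H y∈H)
      where
      x∈H = into-H x∈ x≢w
      y∈H = into-H y∈ y≢w

  restore-leaf : CliqueTreeGraph (induced E A)
  restore-leaf = loopless∧mult≤1⇒Simple G loopless mult≤1 , component

YesCTVD-delete : ∀ {n} (E : List (Fin n × Fin n)) k v → YesCTVD (full E) k → YesCTVD (full E ∖ᵛ v) k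
YesCTVD-delete E k v (S , _ , ∣S∣≤k , ok) =
  S - v , (λ x∈ → x∈p∧x≢y⇒x∈p-y ∈⊤ (x∈p-y⇒x≢y x∈)) , ≤-trans (∣p─q∣≤∣p∣ S ⁅ v ⁆) ∣S∣≤k ,
  CliqueTreeGraph-induced E survivors ok
  where
  survivors : (⊤ - v) ─ (S - v) ⊆ ⊤ ─ S
  survivors x∈ = x∈p∧x∉q⇒x∈p─q ∈⊤ λ x∈S →
    x∈p─q⇒x∉q x∈ (x∈p∧x≢y⇒x∈p-y x∈S (x∈p-y⇒x≢y (p─q⊆p (⊤ - v) (S - v) x∈)))

module _ {n} (E : List (Fin n × Fin n)) {u w : Fin n}
         (u~w : Adj (full E) u w) (w-pendant : Pendant (full E) w) where

  pendant⇒degree-induced≤1 : ∀ {A} → degree (induced E A) w ≤ 1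
  pendant⇒degree-induced≤1 = ≤-trans (degree-induced E w (λ _ → ∈⊤)) (≤-reflexive (proj₂ w-pendant))

  restore-pendant : ∀ {A} → CompTree (induced E (A - w)) u → CliqueTreeGraph (induced E (A - w)) →
                    CliqueTreeGraph (induced E A)
  restore-pendant = restore-leaf E pendant⇒degree-induced≤1 λ w~y →
    degree≤1⇒unique-neighbour (full E) (≤-reflexive (proj₂ w-pendant))
                              (Adj-induced E w~y ∈⊤ ∈⊤) (Adj-sym (full E) u~w)

  pendant-neighbour⇒tree : ∀ {A} → u ∈ A → w ∈ A → CliqueTreeGraph (induced E A) →
                           CompTree (induced E A) u
  pendant-neighbour⇒tree u∈ w∈ (_ , component) with component u u∈
  ... | inj₁ clique =
    clique-with-leaf⇒tree (induced E _) pendant⇒degree-induced≤1 (Adj-induced E u~w u∈ w∈) clique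
  ... | inj₂ tree   = tree

exchange-pendant-for-neighbour : ∀ {n} (E : List (Fin n × Fin n)) k {u v v′ S′} →
  Adj (full E) u v → Adj (full E) u v′ → Pendant (full E) v → Pendant (full E) v′ →
  v′ ∈ S′ → ∣ S′ ∣ ≤ k → CliqueTreeGraph (induced E ((⊤ - v) ─ S′)) → YesCTVD (full E) k
exchange-pendant-for-neighbour E k {u} {v} {v′} {S′} u~v u~v′ v-pendant v′-pendant v′∈S′ ∣S′∣≤k ok =
  S , (λ _ → ∈⊤) , ∣S∣≤k ,
  restore-pendant E u~v v-pendant (∉V⇒CompTree _ (u∉A ∘ p─q⊆p A ⁅ v ⁆))
    (restore-pendant E u~v′ v′-pendant (∉V⇒CompTree _ (u∉A ∘ p─q⊆p A ⁅ v ⁆ ∘ p─q⊆p (A - v) ⁅ v′ ⁆))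
      (CliqueTreeGraph-induced E survivors ok))
  where
  S = (S′ - v′) ∪ ⁅ u ⁆
  A = ⊤ ─ S

  u∉A : u ∉ A
  u∉A u∈ = x∈p─q⇒x∉q u∈ (x∈p∪q⁺ (inj₂ (x∈⁅x⁆ u)))

  survivors : A - v - v′ ⊆ (⊤ - v) ─ S′
  survivors x∈ with p─q⊆p (A - v) ⁅ v′ ⁆ x∈
  ... | x∈A-v = x∈p∧x∉q⇒x∈p─q (x∈p∧x≢y⇒x∈p-y ∈⊤ (x∈p-y⇒x≢y x∈A-v)) λ x∈S′ →
    x∈p─q⇒x∉q (p─q⊆p A ⁅ v ⁆ x∈A-v) (x∈p∪q⁺ (inj₁ (x∈p∧x≢y⇒x∈p-y x∈S′ (x∈p-y⇒x≢y x∈))))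

  ∣S∣≤k : ∣ S ∣ ≤ k
  ∣S∣≤k = begin
    ∣ S ∣                     ≤⟨ ∣p∪q∣≤∣p∣+∣q∣ (S′ - v′) ⁅ u ⁆ ⟩
    ∣ S′ - v′ ∣ + ∣ ⁅ u ⁆ ∣   ≡⟨ cong (∣ S′ - v′ ∣ +_) (∣⁅x⁆∣≡1 u) ⟩
    ∣ S′ - v′ ∣ + 1           ≡⟨ +-comm ∣ S′ - v′ ∣ 1 ⟩
    suc ∣ S′ - v′ ∣           ≤⟨ x∈p⇒∣p-x∣<∣p∣ v′∈S′ ⟩
    ∣ S′ ∣                    ≤⟨ ∣S′∣≤k ⟩
    k                         ∎
    where open ≤-Reasoning

lemma13 : ∀ {n} (E : List (Fin n × Fin n)) (k : ℕ) (u v v′ : Fin n) →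
          v ≢ v′ → Adj (full E) u v → Adj (full E) u v′ →
          Pendant (full E) v → Pendant (full E) v′ →
          YesCTVD (full E) k ⇔ YesCTVD (full E ∖ᵛ v) k
lemma13 E k u v v′ v≢v′ u~v@(_ , _ , u≢v , _) u~v′ v-pendant v′-pendant = mk⇔ (YesCTVD-delete E k v) restore
  where
  restore : YesCTVD (full E ∖ᵛ v) k → YesCTVD (full E) k
  restore (S′ , _ , ∣S′∣≤k , ok) = by-cases (u ∈? S′) (v′ ∈? S′)
    where
    A = ⊤ ─ S′

    ok′ : CliqueTreeGraph (induced E (A - v))
    ok′ = subst (CliqueTreeGraph ∘ induced E) (p─q─r≡p─r─q ⊤ ⁅ v ⁆ S′) ok

    keep-S′ : CompTree (induced E (A - v)) u → YesCTVD (full E) k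
    keep-S′ u-tree = S′ , (λ _ → ∈⊤) , ∣S′∣≤k , restore-pendant E u~v v-pendant u-tree ok′

    survivor : ∀ {x} → x ∉ S′ → x ≢ v → x ∈ A - v
    survivor x∉S′ x≢v = x∈p∧x≢y⇒x∈p-y (x∈p∧x∉q⇒x∈p─q ∈⊤ x∉S′) x≢v

    by-cases : Dec (u ∈ S′) → Dec (v′ ∈ S′) → YesCTVD (full E) k
    by-cases (yes u∈S′) _           = keep-S′ (∉V⇒CompTree _ λ u∈ → x∈p─q⇒x∉q (p─q⊆p A ⁅ v ⁆ u∈) u∈S′)
    by-cases (no _)     (yes v′∈S′) =
      exchange-pendant-for-neighbour E k u~v u~v′ v-pendant v′-pendant v′∈S′ ∣S′∣≤k ok
    by-cases (no u∉S′)  (no v′∉S′)  = keep-S′ (pendant-neighbour⇒tree E u~v′ v′-pendant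
      (survivor u∉S′ u≢v) (survivor v′∉S′ (≢-sym v≢v′)) ok′)
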